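{- Let $m\ge 4$ and let $n\ge \frac{m(m-1)}{2}$ be integers. Then \[RS_m(n)\ge \left\lceil \frac{(m-3)n+\frac{m(m-1)}{2}}{m-2}\right\rceil.\]
   Context: For $m\ge 3$, $E_m$ denotes the equation $x_1+x_2+\cdots+x_{m-1}=x_m$. For a positive integer $n$, $[1,n]=\{1,2,\ldots,n\}$. An $r$-coloring of a set $S$ is a map $S\to\{1,\ldots,r\}$; it is exact if it is surjective. A solution to $E_m$ in $[1,n]$ is a tuple $(x_1,\ldots,x_m)$ of elements of $[1,n]$ satisfying $E_m$; under a coloring it is rainbow if the $m$ elements $x_1,\ldots,x_m$ receive pairwise distinct colors. For $m\ge 3$ and $n\ge \frac{m(m-1)}{2}$, the rainbow Schur number $RS_m(n)$ is the minimum positive integer $r$ such that every exact $r$-coloring of $[1,n]$ admits a rainbow solution to $E_m$ in $[1,n]$. -}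

module Defs where

open import Data.Nat using (ℕ; zero; suc; _+_; _*_; _∸_; _≤_; _/_; NonZero)
open import Data.Nat.DivMod using ()
open import Data.Fin using (Fin; toℕ)
open import Data.Product using (Σ; _×_; ∃)
open import Data.Sum using (_⊎_)
open import Relation.Binary.PropositionalEquality using (_≡_; _≢_)
open import Function.Definitions using (Surjective)

-- An element i : Fin n represents the integer toℕ i + 1 ∈ [1,n].
val : {n : ℕ} → Fin n → ℕ
val i = suc (toℕ i)

sumVals : {k n : ℕ} → (Fin k → Fin n) → ℕ
sumVals {zero}  f = 0
sumVals {suc k} f = val (f Data.Fin.zero) + sumVals (λ i → f (Data.Fin.suc i))

Coloring : ℕ → ℕ → Set
Coloring n r = Fin n → Fin r

Exact : {n r : ℕ} → Coloring n r → Set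
Exact c = Surjective _≡_ _≡_ c

-- A solution of E_m in [1,n] (m ≥ 3), written as (x_1,…,x_{m-1}) = xs and x_m = y,
-- which is rainbow under c: the m colors c(x_1),…,c(x_m) are pairwise distinct.
RainbowSolution : (m n r : ℕ) → Coloring n r → Set
RainbowSolution m n r c =
  Σ (Fin (m ∸ 1) → Fin n) λ xs → Σ (Fin n) λ y →
    (sumVals xs ≡ val y)
    × (∀ i j → c (xs i) ≡ c (xs j) → i ≡ j)
    × (∀ i → c (xs i) ≢ c y)

-- Property defining RS_m(n): every exact r-coloring of [1,n] admits a rainbow solution.
AllExactRainbow : (m n r : ℕ) → Set
AllExactRainbow m n r = (c : Coloring n r) → Exact c → RainbowSolution m n r c

ceilDiv : ℕ → (b : ℕ) → .{{NonZero b}} → ℕ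
ceilDiv a b = (a + (b ∸ 1)) / b

{-# OPTIONS --safe #-}
-- Put d = n − r and colour [1, d + 1] with one colour and each of d + 2, …, n with a
-- colour of its own; this is an exact r-colouring when r ≤ n. The m − 1 summands of a
-- rainbow solution have distinct colours, so at most one of them lies in [1, d + 1] and
-- their sum is at least 1 + (d + 2) + ⋯ + (d + m − 1) = (m − 2) d + m(m − 1)/2. That
-- exceeds n as soon as (m − 2) r < (m − 3) n + m(m − 1)/2.
module Submission where

open import Defs
open import Data.Nat
  using (ℕ; zero; suc; _+_; _*_; _∸_; _≤_; _<_; _/_; z≤n; s≤s; s≤s⁻¹; _≤?_; NonZero; >-nonZero)
open import Data.Nat.Properties
open import Data.Nat.DivMod using (m*n/n≡m; m<n*o⇒m/o<n)
open import Data.Fin using (Fin; toℕ; fromℕ; fromℕ<; inject₁)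
open import Data.Fin.Properties
  using (toℕ<n; toℕ-injective; toℕ-fromℕ; toℕ-fromℕ<; toℕ-inject₁; fromℕ<-injective;
         punchIn-injective; any?; pigeonhole)
  renaming (<⇒≢ to <⇒≢ᶠ)
open import Data.Vec.Functional using (removeAt)
open import Data.Product using (∃; _,_)
open import Function using (_∘_; Injective)
open import Relation.Binary.Core using (_Preserves_⟶_)
open import Relation.Binary.PropositionalEquality
open import Relation.Nullary using (¬_; yes; no; contradiction)
open import Algebra.Properties.CommutativeMonoid.Sum +-0-commutativeMonoid
  using (sum; sum-syntax; sum-remove; sum-init-last; sum-cong-≗; ∑-distrib-+)

sum-mono-≤ : ∀ {k} {f g : Fin k → ℕ} → (∀ i → f i ≤ g i) → sum f ≤ sum g
sum-mono-≤ {zero}  f≤g = z≤n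
sum-mono-≤ {suc k} f≤g = +-mono-≤ (f≤g _) (sum-mono-≤ (f≤g ∘ Fin.suc))

∑-toℕ-last : ∀ (g : ℕ → ℕ) k → ∑[ i < suc k ] g (toℕ i) ≡ ∑[ i < k ] g (toℕ i) + g k
∑-toℕ-last g k = begin
  ∑[ i < suc k ] g (toℕ i)                          ≡⟨ sum-init-last (g ∘ toℕ) ⟩
  ∑[ i < k ] g (toℕ (inject₁ i)) + g (toℕ (fromℕ k)) ≡⟨ cong₂ _+_ (sum-cong-≗ {k} (cong g ∘ toℕ-inject₁))
                                                                  (cong g (toℕ-fromℕ k)) ⟩
  ∑[ i < k ] g (toℕ i) + g k                        ∎
  where open ≡-Reasoning

∑-const : ∀ k d → ∑[ i < k ] d ≡ k * d
∑-const zero    d = refl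
∑-const (suc k) d = cong (d +_) (∑-const k d)

∑-suc-toℕ*2 : ∀ k → ∑[ i < k ] suc (toℕ i) * 2 ≡ suc k * k
∑-suc-toℕ*2 zero    = refl
∑-suc-toℕ*2 (suc k) = begin
  ∑[ i < suc k ] suc (toℕ i) * 2         ≡⟨ cong (_* 2) (∑-toℕ-last suc k) ⟩
  (∑[ i < k ] suc (toℕ i) + suc k) * 2   ≡⟨ *-distribʳ-+ 2 (∑[ i < k ] suc (toℕ i)) (suc k) ⟩
  ∑[ i < k ] suc (toℕ i) * 2 + suc k * 2 ≡⟨ cong (_+ suc k * 2) (∑-suc-toℕ*2 k) ⟩
  suc k * k + suc k * 2                  ≡⟨ *-distribˡ-+ (suc k) k 2 ⟨
  suc k * (k + 2)                        ≡⟨ cong (suc k *_) (+-comm k 2) ⟩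
  suc k * suc (suc k)                    ≡⟨ *-comm (suc k) (suc (suc k)) ⟩
  suc (suc k) * suc k                    ∎
  where open ≡-Reasoning

∑-suc-toℕ : ∀ k → ∑[ i < k ] suc (toℕ i) ≡ suc k * k / 2
∑-suc-toℕ k = begin
  ∑[ i < k ] suc (toℕ i)         ≡⟨ m*n/n≡m _ 2 ⟨
  ∑[ i < k ] suc (toℕ i) * 2 / 2 ≡⟨ cong (_/ 2) (∑-suc-toℕ*2 k) ⟩
  suc k * k / 2                  ∎
  where open ≡-Reasoning

injective⇒¬bounded : ∀ {k} (f : Fin (suc k) → ℕ) → Injective _≡_ _≡_ f → ¬ (∀ i → f i < k)
injective⇒¬bounded f f-inj f<k
  with i , j , i<j , fi≡fj ← pigeonhole ≤-refl (λ i → fromℕ< (f<k i))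
  = <⇒≢ᶠ i<j (f-inj (fromℕ<-injective _ _ (f<k i) (f<k j) fi≡fj))

injective⇒∃-≥ : ∀ {k} (f : Fin (suc k) → ℕ) → Injective _≡_ _≡_ f → ∃ λ i → k ≤ f i
injective⇒∃-≥ {k} f f-inj with any? (λ i → k ≤? f i)
... | yes found = found
... | no  none  = contradiction (λ i → ≰⇒> (λ k≤fi → none (i , k≤fi))) (injective⇒¬bounded f f-inj)

∑-mono-injective : ∀ {g : ℕ → ℕ} → g Preserves _≤_ ⟶ _≤_ →
                   ∀ {k} (f : Fin k → ℕ) → Injective _≡_ _≡_ f →
                   ∑[ i < k ] g (toℕ i) ≤ ∑[ i < k ] g (f i)
∑-mono-injective g-mono {zero}  f f-inj = z≤n
∑-mono-injective {g} g-mono {suc k} f f-inj with i , k≤fi ← injective⇒∃-≥ f f-inj = begin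
  ∑[ j < suc k ] g (toℕ j)           ≡⟨ ∑-toℕ-last g k ⟩
  ∑[ j < k ] g (toℕ j) + g k         ≤⟨ +-mono-≤ (∑-mono-injective g-mono (removeAt f i) removeAt-inj)
                                                 (g-mono k≤fi) ⟩
  sum (removeAt (g ∘ f) i) + g (f i) ≡⟨ +-comm _ (g (f i)) ⟩
  g (f i) + sum (removeAt (g ∘ f) i) ≡⟨ sum-remove (g ∘ f) ⟨
  ∑[ j < suc k ] g (f j)             ∎
  where
  open ≤-Reasoning
  removeAt-inj : Injective _≡_ _≡_ (removeAt f i)
  removeAt-inj = punchIn-injective i _ _ ∘ f-inj

-- Values 1, …, n − r + 1 share colour 0; every larger value has a colour of its own.
collapse : ∀ n r .{{_ : NonZero r}} → Coloring n r
collapse n r x = fromℕ< (m<n+o⇒m∸n<o (toℕ x) (n ∸ r) x<n∸r+r)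
  where
  x<n∸r+r : toℕ x < n ∸ r + r
  x<n∸r+r = <-≤-trans (toℕ<n x) (≤-trans (m≤n+m∸n n r) (≤-reflexive (+-comm r (n ∸ r))))

toℕ-collapse : ∀ {n r} .{{_ : NonZero r}} (x : Fin n) → toℕ (collapse n r x) ≡ toℕ x ∸ (n ∸ r)
toℕ-collapse x = toℕ-fromℕ< _

collapse-exact : ∀ {n r} .{{_ : NonZero r}} → r ≤ n → Exact (collapse n r)
collapse-exact {n} {r} r≤n c = x , λ { refl → toℕ-injective (begin
    toℕ (collapse n r x)      ≡⟨ toℕ-collapse x ⟩
    toℕ x ∸ (n ∸ r)           ≡⟨ cong (_∸ (n ∸ r)) (toℕ-fromℕ< c+n∸r<n) ⟩
    toℕ c + (n ∸ r) ∸ (n ∸ r) ≡⟨ m+n∸n≡m (toℕ c) (n ∸ r) ⟩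
    toℕ c                     ∎) }
  where
  open ≡-Reasoning
  c+n∸r<n : toℕ c + (n ∸ r) < n
  c+n∸r<n = <-≤-trans (+-monoˡ-< (n ∸ r) (toℕ<n c))
                      (≤-reflexive (trans (+-comm r (n ∸ r)) (m∸n+n≡m r≤n)))
  x : Fin n
  x = fromℕ< c+n∸r<n

-- The least value of colour i under collapse n r, where d = n ∸ r.
minOfColour : ℕ → ℕ → ℕ
minOfColour d zero    = 1
minOfColour d (suc i) = suc (suc i) + d

minOfColour-mono : ∀ d → minOfColour d Preserves _≤_ ⟶ _≤_
minOfColour-mono d {zero}  {zero}  _         = ≤-refl
minOfColour-mono d {zero}  {suc j} _         = s≤s z≤n
minOfColour-mono d {suc i} {suc j} (s≤s i≤j) = +-monoˡ-≤ d (s≤s (s≤s i≤j))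

minOfColour[x∸d]≤1+x : ∀ d x → minOfColour d (x ∸ d) ≤ suc x
minOfColour[x∸d]≤1+x d x with d ≤? x
... | no  d≰x rewrite m≤n⇒m∸n≡0 (<⇒≤ (≰⇒> d≰x)) = s≤s z≤n
... | yes d≤x with x ∸ d in x∸d≡i
...   | zero  = s≤s z≤n
...   | suc i = ≤-reflexive (cong suc (begin
  suc i + d   ≡⟨ cong (_+ d) x∸d≡i ⟨
  x ∸ d + d   ≡⟨ m∸n+n≡m d≤x ⟩
  x           ∎))
  where open ≡-Reasoning

∑-minOfColour : ∀ d k → ∑[ i < suc k ] minOfColour d (toℕ i) ≡ k * d + suc (suc k) * suc k / 2
∑-minOfColour d k = begin
  ∑[ i < suc k ] minOfColour d (toℕ i)
    ≡⟨⟩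
  1 + ∑[ i < k ] (suc (suc (toℕ i)) + d)
    ≡⟨ cong suc (∑-distrib-+ {k} (suc ∘ suc ∘ toℕ) (λ _ → d)) ⟩
  1 + (∑[ i < k ] suc (suc (toℕ i)) + ∑[ i < k ] d)
    ≡⟨ cong (λ s → 1 + (∑[ i < k ] suc (suc (toℕ i)) + s)) (∑-const k d) ⟩
  1 + (∑[ i < k ] suc (suc (toℕ i)) + k * d)
    ≡⟨ cong suc (+-comm _ (k * d)) ⟩
  1 + (k * d + ∑[ i < k ] suc (suc (toℕ i)))
    ≡⟨ +-suc (k * d) _ ⟨
  k * d + ∑[ i < suc k ] suc (toℕ i)
    ≡⟨ cong (k * d +_) (∑-suc-toℕ (suc k)) ⟩
  k * d + suc (suc k) * suc k / 2
    ∎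
  where open ≡-Reasoning

sumVals≡∑ : ∀ {k n} (xs : Fin k → Fin n) → sumVals xs ≡ ∑[ i < k ] val (xs i)
sumVals≡∑ {zero}  xs = refl
sumVals≡∑ {suc k} xs = cong (val (xs Fin.zero) +_) (sumVals≡∑ (xs ∘ Fin.suc))

rainbow-collapse-sum : ∀ k {n r} .{{_ : NonZero r}} → RainbowSolution (2 + k) n r (collapse n r) →
                       k * (n ∸ r) + (2 + k) * (1 + k) / 2 ≤ n
rainbow-collapse-sum k {n} {r} (xs , y , xs-sum , distinct , _) = begin
  k * d + (2 + k) * (1 + k) / 2           ≡⟨ ∑-minOfColour d k ⟨
  ∑[ i < suc k ] minOfColour d (toℕ i)    ≤⟨ ∑-mono-injective (minOfColour-mono d) colour colour-inj ⟩
  ∑[ i < suc k ] minOfColour d (colour i) ≤⟨ sum-mono-≤ colour-≤ ⟩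
  ∑[ i < suc k ] val (xs i)               ≡⟨ sumVals≡∑ xs ⟨
  sumVals xs                              ≡⟨ xs-sum ⟩
  val y                                   ≤⟨ toℕ<n y ⟩
  n                                       ∎
  where
  open ≤-Reasoning
  d : ℕ
  d = n ∸ r
  colour : Fin (suc k) → ℕ
  colour = toℕ ∘ collapse n r ∘ xs
  colour-inj : Injective _≡_ _≡_ colour
  colour-inj = distinct _ _ ∘ toℕ-injective
  colour-≤ : ∀ i → minOfColour d (colour i) ≤ val (xs i)
  colour-≤ i = subst (λ c → minOfColour d c ≤ val (xs i)) (sym (toℕ-collapse (xs i)))
                     (minOfColour[x∸d]≤1+x d (toℕ (xs i)))

ceilDiv-≤ : ∀ {a b} r → a ≤ r * suc b → ceilDiv a (suc b) ≤ r
ceilDiv-≤ {a} {b} r a≤r*b = s≤s⁻¹ (m<n*o⇒m/o<n (begin-strict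
  a + b               ≤⟨ +-monoˡ-≤ b a≤r*b ⟩
  r * suc b + b       <⟨ n<1+n _ ⟩
  suc (r * suc b + b) ≡⟨ cong suc (+-comm (r * suc b) b) ⟩
  suc r * suc b       ∎))
  where open ≤-Reasoning

r<n : ∀ k {n r C} → C ≤ n → r * suc k < k * n + C → r < n
r<n k {n} {r} {C} C≤n r*k<kn+C = *-cancelʳ-< (suc k) r n (begin-strict
  r * suc k  <⟨ r*k<kn+C ⟩
  k * n + C  ≤⟨ +-monoʳ-≤ (k * n) C≤n ⟩
  k * n + n  ≡⟨ +-comm (k * n) n ⟩
  suc k * n  ≡⟨ *-comm (suc k) n ⟩
  n * suc k  ∎)
  where open ≤-Reasoning

collapse-threshold : ∀ k {n r C} → r ≤ n → r * suc k < k * n + C → n < suc k * (n ∸ r) + C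
collapse-threshold k {n} {r} {C} r≤n r*k<kn+C = begin-strict
  n               ≡⟨ m∸n+n≡m r≤n ⟨
  d + r           <⟨ +-monoʳ-< d r<kd+C ⟩
  d + (k * d + C) ≡⟨ +-assoc d (k * d) C ⟨
  suc k * d + C   ∎
  where
  open ≤-Reasoning
  d : ℕ
  d = n ∸ r
  r<kd+C : r < k * d + C
  r<kd+C = +-cancelˡ-< (k * r) r (k * d + C) (begin-strict
    k * r + r           ≡⟨ +-comm (k * r) r ⟩
    suc k * r           ≡⟨ *-comm (suc k) r ⟩
    r * suc k           <⟨ r*k<kn+C ⟩
    k * n + C           ≡⟨ cong (λ m → k * m + C) (trans (+-comm r d) (m∸n+n≡m r≤n)) ⟨
    k * (r + d) + C     ≡⟨ cong (_+ C) (*-distribˡ-+ k r d) ⟩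
    k * r + k * d + C   ≡⟨ +-assoc (k * r) (k * d) C ⟩
    k * r + (k * d + C) ∎)

theorem1 : (j n : ℕ) → let m = 4 + j in
    (m * (m ∸ 1)) / 2 ≤ n →
    (r : ℕ) → 1 ≤ r → AllExactRainbow m n r →
    ceilDiv ((m ∸ 3) * n + (m * (m ∸ 1)) / 2) (m ∸ 2) ≤ r
theorem1 j n C≤n r 1≤r rainbow with (1 + j) * n + (4 + j) * (3 + j) / 2 ≤? r * (2 + j)
... | yes a≤r*b = ceilDiv-≤ r a≤r*b
... | no  a≰r*b = contradiction
  (rainbow-collapse-sum (2 + j) (rainbow (collapse n r) (collapse-exact r≤n)))
  (<⇒≱ (collapse-threshold (1 + j) r≤n r*b<a))
  where
  instance
    r≢0 : NonZero r
    r≢0 = >-nonZero 1≤r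
  r*b<a : r * (2 + j) < (1 + j) * n + (4 + j) * (3 + j) / 2
  r*b<a = ≰⇒> a≰r*b
  r≤n : r ≤ n
  r≤n = <⇒≤ (r<n (1 + j) C≤n r*b<a)
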